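{- Let $G$ be a connected finite simple graph on at least three vertices. Then the line graph $L(G)$ is isomorphic to an induced subgraph of the $1$-shunt intersection graph $A_1(G)$.
   Context: A $1$-arc of $G$ is an ordered pair $(u,v)$ with $uv\in E(G)$, written $uv$; it can be shunted onto the $1$-arc $vw$ if $w\neq u$ and $vw\in E(G)$. $A_1(G)$ has as vertices the $1$-arcs that can be shunted onto some other $1$-arc; two distinct vertices are adjacent iff the corresponding $1$-arcs share a vertex of $G$. -}

module Defs where

open import Data.Nat using (ℕ)
open import Data.Fin using (Fin; _<_; _≟_)
open import Data.Fin.Properties using ()
open import Data.Bool using (Bool; T; not; _∧_)
open import Data.List using (allFin)
open import Data.Bool.ListAction using (any)
open import Data.Product using (Σ; _×_; _,_; proj₁; proj₂; ∃)
open import Data.Sum using (_⊎_)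
open import Relation.Nullary using (¬_)
open import Relation.Nullary.Decidable using (⌊_⌋)
open import Relation.Binary.PropositionalEquality using (_≡_; _≢_)
open import Function.Bundles using (_⇔_)

record SimpleGraph (n : ℕ) : Set where
  field
    adj   : Fin n → Fin n → Bool
    sym   : ∀ u v → adj u v ≡ adj v u
    loopless : ∀ v → adj v v ≡ Data.Bool.false

open SimpleGraph public

record Graph : Set₁ where
  field
    V   : Set
    Adj : V → V → Set

open Graph public

module _ {n : ℕ} (G : SimpleGraph n) where

  Adjᴳ : Fin n → Fin n → Set
  Adjᴳ u v = T (adj G u v)

  data Reachable : Fin n → Fin n → Set where
    here : ∀ {u} → Reachable u u
    step : ∀ {u v w} → Adjᴳ u v → Reachable v w → Reachable u w

  Connected : Set
  Connected = ∀ u v → Reachable u v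

  -- an edge {u,v}, represented canonically with u < v
  record Edge : Set where
    constructor edge
    field
      lo hi : Fin n
      lo<hi : lo < hi
      isAdj : T (adj G lo hi)

  _∈ₑ_ : Fin n → Edge → Set
  x ∈ₑ e = x ≡ Edge.lo e ⊎ x ≡ Edge.hi e

  LineGraph : Graph
  LineGraph = record
    { V   = Edge
    ; Adj = λ e f → (Edge.lo e , Edge.hi e) ≢ (Edge.lo f , Edge.hi f)
                    × ∃ λ x → x ∈ₑ e × x ∈ₑ f }

  -- the 1-arc uv can be shunted onto some other 1-arc vw (w ≠ u, vw ∈ E(G)),
  -- decided by search over all w
  shuntable : Fin n → Fin n → Bool
  shuntable u v = any (λ w → not ⌊ w ≟ u ⌋ ∧ adj G v w) (allFin n)

  record ShuntArc : Set where
    constructor arc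
    field
      tail head : Fin n
      isAdj     : T (adj G tail head)
      canShunt  : T (shuntable tail head)

  _∈ₐ_ : Fin n → ShuntArc → Set
  x ∈ₐ a = x ≡ ShuntArc.tail a ⊎ x ≡ ShuntArc.head a

  A₁ : Graph
  A₁ = record
    { V   = ShuntArc
    ; Adj = λ a b → (ShuntArc.tail a , ShuntArc.head a) ≢ (ShuntArc.tail b , ShuntArc.head b)
                    × ∃ λ x → x ∈ₐ a × x ∈ₐ b }

IsoToInducedSubgraph : Graph → Graph → Set
IsoToInducedSubgraph H K =
  Σ (V H → V K) λ f →
    (∀ x y → f x ≡ f y → x ≡ y) ×
    (∀ x y → Adj H x y ⇔ Adj K (f x) (f y))

-- Choose for every edge {u,v} an orientation that is a vertex of A₁(G); the
-- resulting arc has the same endpoints as the edge, so the map is injective and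
-- preserves and reflects "distinct and sharing an endpoint". Such an orientation
-- exists: if neither uv nor vu could be shunted, then v would be the only
-- neighbour of u and u the only neighbour of v, so {u,v} would be a connected
-- component, impossible in a connected graph with at least three vertices.
module Submission where

open import Defs
open import Data.Nat using (ℕ; _≥_; s≤s)
open import Data.Fin using (Fin; zero; suc; _≟_; _<_)
open import Data.Fin.Properties using (<-irrelevant; <-asym)
open import Data.Bool using (T; false)
open import Data.Bool.Properties using (T-irrelevant; T-∧; T-not-≡; T?)
open import Data.List using (allFin)
open import Data.List.Membership.Propositional using (lose)
open import Data.List.Membership.Propositional.Properties using (∈-allFin)
open import Data.List.Relation.Unary.Any.Properties using (any⁺)
open import Data.Product using (Σ; ∃; _×_; _,_; proj₁; proj₂)
open import Data.Sum using (_⊎_; inj₁; inj₂; swap)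
open import Function.Base using (_∘_)
open import Function.Bundles using (_⇔_; mk⇔; Equivalence)
open import Relation.Nullary using (¬_; yes; no; contradiction)
open import Relation.Nullary.Decidable using (⌊_⌋; dec-false; isYes≗does)
open import Relation.Binary.PropositionalEquality
  using (_≡_; _≢_; refl; trans; cong; cong₂; subst; subst₂)

exists-distinct-from-two : ∀ {n} → n ≥ 3 → (l h : Fin n) → ∃ λ x → x ≢ l × x ≢ h
exists-distinct-from-two (s≤s (s≤s (s≤s _))) l h with zero ≟ l | zero ≟ h
... | no 0≢l | no 0≢h = zero , 0≢l , 0≢h
... | yes refl | yes refl = suc zero , (λ ()) , (λ ())
... | yes refl | no _ with suc zero ≟ h
...   | yes refl = suc (suc zero) , (λ ()) , (λ ())
...   | no 1≢h = suc zero , (λ ()) , 1≢h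
exists-distinct-from-two (s≤s (s≤s (s≤s _))) l h | no _ | yes refl with suc zero ≟ l
...   | yes refl = suc (suc zero) , (λ ()) , (λ ())
...   | no 1≢l = suc zero , 1≢l , (λ ())

module _ {n : ℕ} (G : SimpleGraph n) where

  Reachable-preserves : (P : Fin n → Set) → (∀ {u v} → Adjᴳ G u v → P u → P v) →
    ∀ {u v} → Reachable G u v → P u → P v
  Reachable-preserves P step-P here        Pu = Pu
  Reachable-preserves P step-P (step uv r) Pu = Reachable-preserves P step-P r (step-P uv Pu)

  shuntable-intro : ∀ {u v w} → Adjᴳ G v w → w ≢ u → T (shuntable G u v)
  shuntable-intro {u} {v} {w} vw w≢u =
    any⁺ _ (lose (∈-allFin w) (Equivalence.from T-∧ (Equivalence.from T-not-≡ w≟u-false , vw)))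
    where
      w≟u-false : ⌊ w ≟ u ⌋ ≡ false
      w≟u-false = trans (isYes≗does (w ≟ u)) (dec-false (w ≟ u) w≢u)

  unshuntable-unique-neighbour : ∀ {u v w} → ¬ T (shuntable G u v) → Adjᴳ G v w → w ≡ u
  unshuntable-unique-neighbour {u} {w = w} ¬uv vw with w ≟ u
  ... | yes w≡u = w≡u
  ... | no  w≢u = contradiction (shuntable-intro vw w≢u) ¬uv

  data Orients : Edge G → Fin n → Fin n → Set where
    forward  : ∀ {l h p a} → Orients (edge l h p a) l h
    backward : ∀ {l h p a} → Orients (edge l h p a) h l

  edge-≡ : ∀ {e e'} → Edge.lo e ≡ Edge.lo e' → Edge.hi e ≡ Edge.hi e' → e ≡ e'
  edge-≡ {edge l h p a} {edge .l .h p' a'} refl refl =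
    cong₂ (edge {G = G} l h) (<-irrelevant p p') (T-irrelevant a a')

  Orients-unique : ∀ {e e' t h} → Orients e t h → Orients e' t h → e ≡ e'
  Orients-unique forward  forward  = edge-≡ refl refl
  Orients-unique backward backward = edge-≡ refl refl
  Orients-unique {edge _ _ l<h _} {edge _ _ h<l _} forward  backward =
    contradiction h<l (<-asym l<h)
  Orients-unique {edge _ _ h<l _} {edge _ _ l<h _} backward forward  =
    contradiction l<h (<-asym h<l)

  Orients-endpoints : ∀ {e t h} → Orients e t h → ∀ x → (x ≡ t ⊎ x ≡ h) ⇔ _∈ₑ_ G x e
  Orients-endpoints forward  x = mk⇔ (λ m → m) (λ m → m)
  Orients-endpoints backward x = mk⇔ swap swap

  module _ (n≥3 : n ≥ 3) (connected : Connected G) where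

    shuntable-either-way : (u v : Fin n) → T (shuntable G u v) ⊎ T (shuntable G v u)
    shuntable-either-way u v with T? (shuntable G u v) | T? (shuntable G v u)
    ... | yes uv | _      = inj₁ uv
    ... | no _   | yes vu = inj₂ vu
    ... | no ¬uv | no ¬vu with exists-distinct-from-two n≥3 u v
    ...   | x , x≢u , x≢v with Reachable-preserves InEdge closed (connected u x) (inj₁ refl)
      where
        InEdge : Fin n → Set
        InEdge x = x ≡ u ⊎ x ≡ v
        closed : ∀ {y z} → Adjᴳ G y z → InEdge y → InEdge z
        closed yz (inj₁ refl) = inj₂ (unshuntable-unique-neighbour ¬vu yz)
        closed yz (inj₂ refl) = inj₁ (unshuntable-unique-neighbour ¬uv yz)
    ...     | inj₁ x≡u = contradiction x≡u x≢u
    ...     | inj₂ x≡v = contradiction x≡v x≢v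

    shuntableOrientation : (e : Edge G) →
      Σ (ShuntArc G) λ a → Orients e (ShuntArc.tail a) (ShuntArc.head a)
    shuntableOrientation (edge l h p a) with shuntable-either-way l h
    ... | inj₁ lh = arc l h a lh , forward
    ... | inj₂ hl = arc h l (subst T (SimpleGraph.sym G l h) a) hl , backward

    arcOf : Edge G → ShuntArc G
    arcOf = proj₁ ∘ shuntableOrientation

    arcOf-orients : ∀ e → Orients e (ShuntArc.tail (arcOf e)) (ShuntArc.head (arcOf e))
    arcOf-orients = proj₂ ∘ shuntableOrientation

    arcOf-endpoints-injective : ∀ e e' →
      ShuntArc.tail (arcOf e) ≡ ShuntArc.tail (arcOf e') →
      ShuntArc.head (arcOf e) ≡ ShuntArc.head (arcOf e') → e ≡ e'
    arcOf-endpoints-injective e e' t≡t' h≡h' =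
      Orients-unique (subst₂ (Orients e) t≡t' h≡h' (arcOf-orients e)) (arcOf-orients e')

    arcOf-embedding : IsoToInducedSubgraph (LineGraph G) (A₁ G)
    arcOf-embedding = arcOf , injective , λ e e' → mk⇔ (preserves e e') (reflects e e')
      where
        injective : ∀ e e' → arcOf e ≡ arcOf e' → e ≡ e'
        injective e e' eq = arcOf-endpoints-injective e e' (cong ShuntArc.tail eq) (cong ShuntArc.head eq)

        endpoints : ∀ e x → _∈ₐ_ G x (arcOf e) ⇔ _∈ₑ_ G x e
        endpoints e = Orients-endpoints (arcOf-orients e)

        preserves : ∀ e e' → Adj (LineGraph G) e e' → Adj (A₁ G) (arcOf e) (arcOf e')
        preserves e e' (e≢e' , x , x∈e , x∈e') =
          (λ eq → e≢e' (cong (λ f → Edge.lo f , Edge.hi f)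
                          (arcOf-endpoints-injective e e' (cong proj₁ eq) (cong proj₂ eq)))) ,
          x , Equivalence.from (endpoints e x) x∈e , Equivalence.from (endpoints e' x) x∈e'

        reflects : ∀ e e' → Adj (A₁ G) (arcOf e) (arcOf e') → Adj (LineGraph G) e e'
        reflects e e' (a≢a' , x , x∈a , x∈a') =
          (λ eq → a≢a' (cong (λ f → ShuntArc.tail (arcOf f) , ShuntArc.head (arcOf f))
                          (edge-≡ (cong proj₁ eq) (cong proj₂ eq)))) ,
          x , Equivalence.to (endpoints e x) x∈a , Equivalence.to (endpoints e' x) x∈a'

mainTheorem18 : (n : ℕ) → n ≥ 3 → (G : SimpleGraph n) → Connected G →
    IsoToInducedSubgraph (LineGraph G) (A₁ G)
mainTheorem18 n n≥3 G connected = arcOf-embedding G n≥3 connected
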